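{- Let $p$ be an odd prime and let $q_p(2)=\frac{2^{p-1}-1}{p}$. Let $M_{p-2}$ be the number of permutations of $p-2$ letters that have an even number of ascents and are distinct from the identity. Then $$q_p(2)\equiv 2M_{p-2}+1\pmod p.$$
   Context: For a permutation $(i_1,\dots,i_n)$ of $\{1,\dots,n\}$ (mapping $j$ to $i_j$), an ascent is an index $k$ with $i_{k+1}>i_k$. -}

module Defs where

open import Data.Nat using (ℕ; zero; suc; _+_; _*_; _∸_; _^_; _<ᵇ_; _≡ᵇ_)
open import Data.Nat.Base using (_%_)
open import Data.Bool using (Bool; true; false; if_then_else_; not; _∧_)
open import Data.List using (List; []; _∷_; map; concatMap; upTo; length; filter)
open import Data.List.Relation.Unary.Unique.Propositional using (Unique)
open import Data.List.Relation.Unary.Unique.Propositional.Properties using ()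
open import Data.List.Relation.Unary.Unique.DecPropositional using (unique?)
open import Data.Nat.Properties using (_≟_)
open import Relation.Nullary.Decidable using (does)
open import Data.Bool.Properties using (T?)

words : ℕ → ℕ → List (List ℕ)
words n zero    = [] ∷ []
words n (suc k) = concatMap (λ w → map (λ a → a ∷ w) (upTo n)) (words n k)

-- One-line notations (i₁, …, iₙ) of the permutations of {0, …, n-1}
-- (letters shifted by one relative to {1,…,n}, which does not affect ascents):
-- the words of length n over {0,…,n-1} with no repeated letter.
perms : ℕ → List (List ℕ)
perms n = filter (unique? _≟_) (words n n)

ascents : List ℕ → ℕ
ascents []           = 0
ascents (x ∷ [])     = 0
ascents (x ∷ y ∷ xs) = (if x <ᵇ y then 1 else 0) + ascents (y ∷ xs)

isEven : ℕ → Bool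
isEven n = n % 2 ≡ᵇ 0

identity : ℕ → List ℕ
identity n = upTo n

eqList : List ℕ → List ℕ → Bool
eqList []       []       = true
eqList (x ∷ xs) (y ∷ ys) = (x ≡ᵇ y) ∧ eqList xs ys
eqList _        _        = false

M : ℕ → ℕ
M n = length (filter (λ w → T? (isEven (ascents w) ∧ not (eqList w (identity n)))) (perms n))

module Submission where

-- Write p = 2K + 3 and n = p − 2, and read m^n as 1/m modulo p. Inserting the largest letter
-- into permutations proves Worpitzky's identity Σ_σ C(m + asc σ, n) = m^n, and Pascal's rule
-- turns it into Σ_σ C(j + asc σ, n + 1) = Σ_{m<j} m^n. Modulo p, C(N, p − 1) ≡ [N = p − 1]
-- for N < 2p − 1, so summing over j = 2, 4, …, p − 1 picks out exactly the permutations with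
-- an even number a of ascents (j + a = p − 1): their number E satisfies
-- E ≡ Σ_{i≤K} Σ_{m<2i+2} 1/m, and exchanging the sums gives 2E ≡ −n − S with S = Σ_{j≤K} 1/(2j).
-- On the other side 2q_p(2) = Σ_{0<k<p} C(p,k)/p and k·C(p,k)/p = C(p − 1, k − 1) ≡ (−1)^(k−1),
-- so 2q_p(2) ≡ Σ_k (−1)^(k−1)/k; pairing 1/k with 1/(p − k) = −1/k yields 2q_p(2) ≡ 2 − 2S.
-- Since E = M + 1 (the identity has 2K ascents), 2(2M + 1) ≡ 2q_p(2), and 2 is invertible.

open import Data.Bool using (Bool; true; false; T; if_then_else_; not; _∧_)
open import Data.List using (List; []; _∷_; _++_; [_]; map; concatMap; drop; filter; length; upTo; applyUpTo)
open import Data.List.Membership.Propositional using (_∈_; _∉_; find)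
open import Data.List.Relation.Unary.All as All using (All; []; _∷_)
open import Data.List.Relation.Unary.Any as Any using (here; there)
open import Data.Nat.ListAction using (sum)
open import Data.Product using (∃₂; ∃-syntax; _×_; _,_; proj₂)
open import Data.Sum using (_⊎_; inj₁; inj₂)
open import Function using (_∘_; case_of_)
open import Relation.Binary.PropositionalEquality
  using (_≡_; _≢_; refl; sym; trans; cong; cong₂; subst; setoid; ≢-sym; module ≡-Reasoning)
open import Relation.Nullary using (¬_; yes; no; ¬?; does; contradiction)

open import Defs

-- ℕ and ℤ each get their own module so that both sets of operators can be used unqualified.
module Combinatorics where

  open import Data.Bool.Properties using (T?; T-≡; ∧-identityʳ)
  open import Data.List.Membership.Propositional.Properties
    using (∈-map⁺; ∈-map⁻; ∈-∃++; ∈-concatMap⁺; ∈-concatMap⁻; ∈-filter⁺; ∈-filter⁻; ∈-upTo⁺; ∈-upTo⁻)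
  open import Data.List.Properties
    using (∷-injectiveˡ; ∷-injectiveʳ; filter-++; filter-all; filter-reject; map-++; map-∘; map-cong-local; length-upTo)
  open import Data.List.Relation.Binary.Permutation.Propositional
    using (_↭_; ↭-refl; ↭-sym; ↭-trans; prep; ↭⇒↭ₛ)
  open import Data.List.Relation.Binary.Permutation.Propositional.Properties
    using (shift; ∈-resp-↭; All-resp-↭; ↭-length; filter-↭)
  import Data.List.Relation.Binary.Permutation.Setoid.Properties as Permutationₛ
  open import Data.List.Relation.Binary.Subset.Propositional using (_⊆_)
  open import Data.List.Relation.Unary.All.Properties using (¬Any⇒All¬; ++⁻ˡ; ++⁻ʳ)
  open import Data.List.Relation.Unary.AllPairs using ([]; _∷_)
  open import Data.List.Relation.Unary.Unique.Propositional using (Unique)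
  import Data.List.Relation.Unary.Unique.Propositional.Properties as Unique
  open import Data.List.Relation.Unary.Unique.DecPropositional using (unique?)
  open import Data.Empty using (⊥; ⊥-elim)
  open import Data.Nat using (ℕ; zero; suc; _+_; _*_; _∸_; _^_; _≤_; _<_; _≟_; _<ᵇ_; _≡ᵇ_; z≤n; s≤s)
  open import Data.Nat.Properties
    using (*-comm; *-distribʳ-+; *-distribˡ-+; *-zeroʳ; +-assoc; +-cancelʳ-≡; +-comm; +-identityʳ; +-suc; +-∸-assoc;
           <-asym; <-irrefl; <-trans; <ᵇ⇒<; <⇒<ᵇ; m+n∸m≡n; m≤n⇒m<n∨m≡n; m≤n⇒m≤1+n; m≤n⇒∃[o]m+o≡n; n<1+n;
           suc-injective; ≡ᵇ⇒≡; ≡⇒≡ᵇ)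
  open import Data.List.Membership.DecPropositional _≟_ using (_∈?_)
  open import Data.Nat.Combinatorics using (_C_; nC1≡n; k>n⇒nCk≡0; nCk+nC[k+1]≡[n+1]C[k+1])
  open import Data.Nat.ListAction.Properties using (sum-++)
  open import Data.Nat.Tactic.RingSolver using (solve-∀)
  open import Function using (Equivalence)

  module _ {A : Set} where

    Unique-resp-↭ : {xs ys : List A} → xs ↭ ys → Unique xs → Unique ys
    Unique-resp-↭ p = Permutationₛ.Unique-resp-↭ (setoid A) (↭⇒↭ₛ p)

    unique-⊆-⊇⇒↭ : {xs ys : List A} → Unique xs → Unique ys → xs ⊆ ys → ys ⊆ xs → xs ↭ ys
    unique-⊆-⊇⇒↭ {[]}    {[]}    _ _ _ _   = ↭-refl
    unique-⊆-⊇⇒↭ {[]}    {_ ∷ _} _ _ _ ys⊆ = case ys⊆ (here refl) of λ ()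
    unique-⊆-⊇⇒↭ {x ∷ xs} (x∉xs ∷ xs!) ys! xs⊆ ys⊆ with ∈-∃++ (xs⊆ (here refl))
    ... | us , vs , refl with Unique-resp-↭ (shift x us vs) ys!
    ... | x∉uv ∷ uv! = ↭-trans (prep x (unique-⊆-⊇⇒↭ xs! uv! sub sup)) (↭-sym (shift x us vs))
      where
      sub : xs ⊆ us ++ vs
      sub z∈ = Any.tail (All.lookup x∉xs z∈ ∘ sym)
                        (∈-resp-↭ (shift x us vs) (xs⊆ (there z∈)))
      sup : us ++ vs ⊆ xs
      sup z∈ = Any.tail (All.lookup x∉uv z∈ ∘ sym)
                        (ys⊆ (∈-resp-↭ (↭-sym (shift x us vs)) (there z∈)))

    module _ {B : Set} (f : A → List B) (retract : B → A) where

      concatMap-unique : {xs : List A} →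
        All (λ x → Unique (f x) × (∀ {z} → z ∈ f x → retract z ≡ x)) xs →
        Unique xs → Unique (concatMap f xs)
      concatMap-unique {[]} [] [] = []
      concatMap-unique {x ∷ xs} ((fx! , inv) ∷ hyp) (x∉xs ∷ xs!) =
        Unique.++⁺ fx! (concatMap-unique hyp xs!) disjoint
        where
        disjoint : ∀ {z} → z ∈ f x × z ∈ concatMap f xs → ⊥
        disjoint (z∈fx , z∈rest) with find (∈-concatMap⁻ f z∈rest)
        ... | y , y∈xs , z∈fy =
          All.lookup x∉xs y∈xs (trans (sym (inv z∈fx)) (proj₂ (All.lookup hyp y∈xs) z∈fy))

  insertions : ℕ → List ℕ → List (List ℕ)
  insertions v []       = [ v ] ∷ []
  insertions v (x ∷ xs) = (v ∷ x ∷ xs) ∷ map (x ∷_) (insertions v xs)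

  ∈-insertions⁺ : ∀ v us ws → us ++ v ∷ ws ∈ insertions v (us ++ ws)
  ∈-insertions⁺ v []       []       = here refl
  ∈-insertions⁺ v []       (_ ∷ _)  = here refl
  ∈-insertions⁺ v (u ∷ us) ws       = there (∈-map⁺ (u ∷_) (∈-insertions⁺ v us ws))

  ∈-insertions⁻ : ∀ v σ {τ} → τ ∈ insertions v σ → ∃₂ λ us ws → τ ≡ us ++ v ∷ ws × σ ≡ us ++ ws
  ∈-insertions⁻ v []       (here refl) = [] , [] , refl , refl
  ∈-insertions⁻ v (x ∷ xs) (here refl) = [] , x ∷ xs , refl , refl
  ∈-insertions⁻ v (x ∷ xs) (there τ∈) with ∈-map⁻ (x ∷_) τ∈
  ... | τ′ , τ′∈ , refl with ∈-insertions⁻ v xs τ′∈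
  ... | us , ws , refl , refl = x ∷ us , ws , refl , refl

  delete : ℕ → List ℕ → List ℕ
  delete v = filter (λ x → ¬? (x ≟ v))

  delete-insertions : ∀ {v σ τ} → v ∉ σ → τ ∈ insertions v σ → delete v τ ≡ σ
  delete-insertions {v} {σ} v∉σ τ∈ with ∈-insertions⁻ v σ τ∈
  ... | us , ws , refl , refl = begin
    delete v (us ++ v ∷ ws)            ≡⟨ filter-++ (λ x → ¬? (x ≟ v)) us (v ∷ ws) ⟩
    delete v us ++ delete v (v ∷ ws)  ≡⟨ cong (delete v us ++_) (filter-reject (λ x → ¬? (x ≟ v)) (λ v≢v → v≢v refl)) ⟩
    delete v us ++ delete v ws        ≡⟨ cong₂ _++_ (filter-all _ (++⁻ˡ us ≢v)) (filter-all _ (++⁻ʳ us ≢v)) ⟩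
    us ++ ws                          ∎
    where
    open ≡-Reasoning
    ≢v : All (_≢ v) (us ++ ws)
    ≢v = All.map ≢-sym (¬Any⇒All¬ (us ++ ws) v∉σ)

  insertions-unique : ∀ {v σ} → v ∉ σ → Unique (insertions v σ)
  insertions-unique {v} {[]}     _    = [] ∷ []
  insertions-unique {v} {x ∷ xs} v∉σ =
    All.tabulate head∉ ∷ Unique.map⁺ ∷-injectiveʳ (insertions-unique (v∉σ ∘ there))
    where
    head∉ : ∀ {τ} → τ ∈ map (x ∷_) (insertions v xs) → v ∷ x ∷ xs ≢ τ
    head∉ τ∈ eq with ∈-map⁻ (x ∷_) τ∈
    head∉ τ∈ refl | _ , _ , refl = v∉σ (here refl)

  permsByInsertion : ℕ → List (List ℕ)
  permsByInsertion zero    = [] ∷ []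
  permsByInsertion (suc n) = concatMap (insertions n) (permsByInsertion n)

  IsPermutation : ℕ → List ℕ → Set
  IsPermutation n σ = Unique σ × length σ ≡ n × All (_< n) σ

  All-<-pred : ∀ {n σ} → All (_< suc n) σ → n ∉ σ → All (_< n) σ
  All-<-pred []             _   = []
  All-<-pred (s≤s x≤n ∷ xs) n∉σ with m≤n⇒m<n∨m≡n x≤n
  ... | inj₁ x<n  = x<n ∷ All-<-pred xs (n∉σ ∘ there)
  ... | inj₂ refl = ⊥-elim (n∉σ (here refl))

  removeMax : ∀ {n} us ws → Unique (us ++ n ∷ ws) → All (_< suc n) (us ++ n ∷ ws) →
              Unique (us ++ ws) × All (_< n) (us ++ ws)
  removeMax {n} us ws σ! σ< with Unique-resp-↭ (shift n us ws) σ! | All-resp-↭ (shift n us ws) σ<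
  ... | n∉ ∷ uw! | _ ∷ uw< = uw! , All-<-pred uw< (λ n∈ → All.lookup n∉ n∈ refl)

  length-++-∷ : ∀ n (us ws : List ℕ) → length (us ++ n ∷ ws) ≡ suc (length (us ++ ws))
  length-++-∷ n us ws = ↭-length (shift n us ws)

  unique-bounded-length : ∀ n {σ} → Unique σ → All (_< n) σ → length σ ≤ n
  unique-bounded-length zero    {[]}    _  _        = z≤n
  unique-bounded-length zero    {_ ∷ _} _  (() ∷ _)
  unique-bounded-length (suc n) {σ}     σ! σ< with n ∈? σ
  ... | no n∉σ = m≤n⇒m≤1+n (unique-bounded-length n σ! (All-<-pred σ< n∉σ))
  ... | yes n∈σ with ∈-∃++ n∈σ
  ... | us , ws , refl with removeMax us ws σ! σ<
  ... | uw! , uw< = subst (_≤ suc n) (sym (length-++-∷ n us ws)) (s≤s (unique-bounded-length n uw! uw<))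

  isPermutation-max : ∀ {n σ} → IsPermutation (suc n) σ →
    ∃₂ λ us ws → σ ≡ us ++ n ∷ ws × IsPermutation n (us ++ ws)
  isPermutation-max {n} {σ} (σ! , len , σ<) with n ∈? σ
  ... | no n∉σ = ⊥-elim (<-irrefl refl (subst (_≤ n) len (unique-bounded-length n σ! (All-<-pred σ< n∉σ))))
  ... | yes n∈σ with ∈-∃++ n∈σ
  ... | us , ws , refl with removeMax us ws σ! σ<
  ... | uw! , uw< = us , ws , refl , uw! , suc-injective (trans (sym (length-++-∷ n us ws)) len) , uw<

  ∈-permsByInsertion⁻ : ∀ n {σ} → σ ∈ permsByInsertion n → IsPermutation n σ
  ∈-permsByInsertion⁻ zero    (here refl) = [] , refl , []
  ∈-permsByInsertion⁻ (suc n) τ∈ with find (∈-concatMap⁻ (insertions n) τ∈)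
  ... | σ , σ∈ , τ∈ins with ∈-permsByInsertion⁻ n σ∈ | ∈-insertions⁻ n σ τ∈ins
  ... | σ! , len , σ< | us , ws , refl , refl =
    Unique-resp-↭ (↭-sym p) (All.map (λ x<n n≡x → <-irrefl (sym n≡x) x<n) σ< ∷ σ!) ,
    trans (↭-length p) (cong suc len) ,
    All-resp-↭ (↭-sym p) (n<1+n n ∷ All.map (λ x<n → <-trans x<n (n<1+n n)) σ<)
    where p = shift n us ws

  ∈-permsByInsertion⁺ : ∀ n {σ} → IsPermutation n σ → σ ∈ permsByInsertion n
  ∈-permsByInsertion⁺ zero    {[]} _ = here refl
  ∈-permsByInsertion⁺ (suc n) perm with isPermutation-max perm
  ... | us , ws , refl , perm′ =
    ∈-concatMap⁺ (insertions n) (Any.map (λ { refl → ∈-insertions⁺ n us ws }) (∈-permsByInsertion⁺ n perm′))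

  permsByInsertion-unique : ∀ n → Unique (permsByInsertion n)
  permsByInsertion-unique zero    = [] ∷ []
  permsByInsertion-unique (suc n) =
    concatMap-unique (insertions n) (delete n)
      (All.tabulate (λ σ∈ → insertions-unique (n∉ σ∈) , delete-insertions (n∉ σ∈)))
      (permsByInsertion-unique n)
    where
    n∉ : ∀ {σ} → σ ∈ permsByInsertion n → n ∉ σ
    n∉ σ∈ n∈σ with ∈-permsByInsertion⁻ n σ∈
    ... | _ , _ , σ< = <-irrefl refl (All.lookup σ< n∈σ)

  ∈-words⁻ : ∀ n k {w} → w ∈ words n k → length w ≡ k × All (_< n) w
  ∈-words⁻ n zero    (here refl) = refl , []
  ∈-words⁻ n (suc k) aw∈ with find (∈-concatMap⁻ (λ w → map (_∷ w) (upTo n)) aw∈)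
  ... | w , w∈ , aw∈′ with ∈-map⁻ (_∷ w) aw∈′ | ∈-words⁻ n k w∈
  ... | a , a∈ , refl | len , w< = cong suc len , ∈-upTo⁻ a∈ ∷ w<

  ∈-words⁺ : ∀ n {w} → All (_< n) w → w ∈ words n (length w)
  ∈-words⁺ n []           = here refl
  ∈-words⁺ n {a ∷ w} (a<n ∷ w<) =
    ∈-concatMap⁺ (λ w → map (_∷ w) (upTo n)) (Any.map (λ { refl → ∈-map⁺ (_∷ w) (∈-upTo⁺ a<n) }) (∈-words⁺ n w<))

  words-unique : ∀ n k → Unique (words n k)
  words-unique n zero    = [] ∷ []
  words-unique n (suc k) =
    concatMap-unique (λ w → map (_∷ w) (upTo n)) (drop 1)
      (All.tabulate (λ _ → Unique.map⁺ ∷-injectiveˡ (Unique.upTo⁺ n) , tail≡))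
      (words-unique n k)
    where
    tail≡ : ∀ {w z} → z ∈ map (_∷ w) (upTo n) → drop 1 z ≡ w
    tail≡ {w} z∈ with ∈-map⁻ (_∷ w) z∈
    ... | _ , _ , refl = refl

  ∈-perms⁻ : ∀ n {σ} → σ ∈ perms n → IsPermutation n σ
  ∈-perms⁻ n σ∈ with ∈-filter⁻ (unique? _≟_) σ∈
  ... | σ∈words , σ! with ∈-words⁻ n n σ∈words
  ... | len , σ< = σ! , len , σ<

  ∈-perms⁺ : ∀ n {σ} → IsPermutation n σ → σ ∈ perms n
  ∈-perms⁺ n (σ! , refl , σ<) = ∈-filter⁺ (unique? _≟_) (∈-words⁺ n σ<) σ!

  perms↭permsByInsertion : ∀ n → perms n ↭ permsByInsertion n
  perms↭permsByInsertion n =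
    unique-⊆-⊇⇒↭ (Unique.filter⁺ (unique? _≟_) (words-unique n n)) (permsByInsertion-unique n)
      (∈-permsByInsertion⁺ n ∘ ∈-perms⁻ n) (∈-perms⁺ n ∘ ∈-permsByInsertion⁻ n)

  module _ {A : Set} where

    sum-map-concatMap : ∀ {B : Set} (f : B → ℕ) (g : A → List B) xs →
      sum (map f (concatMap g xs)) ≡ sum (map (λ x → sum (map f (g x))) xs)
    sum-map-concatMap f g []       = refl
    sum-map-concatMap f g (x ∷ xs) = begin
      sum (map f (g x ++ concatMap g xs))               ≡⟨ cong sum (map-++ f (g x) _) ⟩
      sum (map f (g x) ++ map f (concatMap g xs))       ≡⟨ sum-++ (map f (g x)) _ ⟩
      sum (map f (g x)) + sum (map f (concatMap g xs))  ≡⟨ cong (sum (map f (g x)) +_) (sum-map-concatMap f g xs) ⟩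
      sum (map f (g x)) + sum (map (λ x → sum (map f (g x))) xs) ∎
      where open ≡-Reasoning

    sum-map-*ˡ : ∀ m (f : A → ℕ) xs → sum (map (λ x → m * f x) xs) ≡ m * sum (map f xs)
    sum-map-*ˡ m f []       = sym (*-zeroʳ m)
    sum-map-*ˡ m f (x ∷ xs) = trans (cong (m * f x +_) (sum-map-*ˡ m f xs)) (sym (*-distribˡ-+ m (f x) _))

    sum-map-+ : ∀ (f g : A → ℕ) xs → sum (map (λ x → f x + g x) xs) ≡ sum (map f xs) + sum (map g xs)
    sum-map-+ f g []       = refl
    sum-map-+ f g (x ∷ xs) rewrite sum-map-+ f g xs = +-+-comm (f x) (g x) (sum (map f xs)) _
      where
      +-+-comm : ∀ a b c d → a + b + (c + d) ≡ a + c + (b + d)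
      +-+-comm = solve-∀

    sum-map-cong : ∀ {f g : A → ℕ} xs → (∀ {x} → x ∈ xs → f x ≡ g x) → sum (map f xs) ≡ sum (map g xs)
    sum-map-cong xs f≡g = cong sum (map-cong-local (All.tabulate f≡g))

    sum-map-0 : ∀ {f : A → ℕ} xs → (∀ {x} → x ∈ xs → f x ≡ 0) → sum (map f xs) ≡ 0
    sum-map-0 []       _    = refl
    sum-map-0 (x ∷ xs) f≡0 rewrite f≡0 (here refl) = sum-map-0 xs (f≡0 ∘ there)

  ∑ℕ : ℕ → (ℕ → ℕ) → ℕ
  ∑ℕ zero    f = 0
  ∑ℕ (suc n) f = ∑ℕ n f + f n

  sum-map-∑ℕ : ∀ {A : Set} m (f : A → ℕ → ℕ) xs →
    sum (map (λ x → ∑ℕ m (f x)) xs) ≡ ∑ℕ m (λ i → sum (map (λ x → f x i) xs))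
  sum-map-∑ℕ zero    f xs = sum-map-0 xs (λ _ → refl)
  sum-map-∑ℕ (suc m) f xs = trans (sum-map-+ (λ x → ∑ℕ m (f x)) (λ x → f x m) xs)
      (cong (_+ sum (map (λ x → f x m) xs)) (sum-map-∑ℕ m f xs))

  <⇒<ᵇ≡true : ∀ {m n} → m < n → (m <ᵇ n) ≡ true
  <⇒<ᵇ≡true = Equivalence.to T-≡ ∘ <⇒<ᵇ

  >⇒<ᵇ≡false : ∀ {m n} → n < m → (m <ᵇ n) ≡ false
  >⇒<ᵇ≡false {m} {n} n<m with m <ᵇ n in eq
  ... | false = refl
  ... | true  = contradiction (<ᵇ⇒< m n (subst T (sym eq) _)) (<-asym n<m)

  ascents≤length : ∀ x xs → ascents (x ∷ xs) ≤ length xs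
  ascents≤length x []       = z≤n
  ascents≤length x (y ∷ ys) with x <ᵇ y
  ... | true  = s≤s (ascents≤length y ys)
  ... | false = m≤n⇒m≤1+n (ascents≤length y ys)

  -- Inserting a new maximum v into one of the length (x ∷ σ) gaps after x leaves the number of
  -- ascents unchanged exactly when the gap sits inside an ascent.
  insertions-ascents-after : ∀ {v} x σ (g : ℕ → ℕ) → x < v → All (_< v) σ →
    let a = ascents (x ∷ σ) in
    sum (map (λ τ → g (ascents (x ∷ τ))) (insertions v σ)) ≡ a * g a + (length (x ∷ σ) ∸ a) * g (suc a)
  insertions-ascents-after x []       g x<v [] rewrite <⇒<ᵇ≡true x<v = refl
  insertions-ascents-after {v} x (y ∷ ys) g x<v (y<v ∷ ys<v)
    rewrite <⇒<ᵇ≡true x<v | >⇒<ᵇ≡false y<v | sym (map-∘ {g = λ τ → g (ascents (x ∷ τ))} {f = y ∷_} (insertions v ys))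
    with x <ᵇ y
  ... | true  rewrite insertions-ascents-after y ys (g ∘ suc) y<v ys<v = sym (+-assoc (g (suc b)) _ _)
    where b = ascents (y ∷ ys)
  ... | false rewrite insertions-ascents-after y ys g y<v ys<v | +-∸-assoc 1 (m≤n⇒m≤1+n (ascents≤length y ys)) =
    regroup (g (suc b)) (b * g b) ((length (y ∷ ys) ∸ b) * g (suc b))
    where
    b = ascents (y ∷ ys)
    regroup : ∀ u w z → u + (w + z) ≡ w + (u + z)
    regroup = solve-∀

  insertions-ascents : ∀ {v} σ (g : ℕ → ℕ) → All (_< v) σ →
    let a = ascents σ in
    sum (map (g ∘ ascents) (insertions v σ)) ≡ suc a * g a + (length σ ∸ a) * g (suc a)
  insertions-ascents []       g []           = cong (_+ 0) (sym (+-identityʳ (g 0)))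
  insertions-ascents {v} (x ∷ xs) g (x<v ∷ xs<v)
    rewrite >⇒<ᵇ≡false x<v | sym (map-∘ {g = g ∘ ascents} {f = x ∷_} (insertions v xs))
          | insertions-ascents-after x xs g x<v xs<v = sym (+-assoc (g (ascents (x ∷ xs))) _ _)

  pascal : ∀ n k → suc n C suc k ≡ n C k + n C suc k
  pascal n k = sym (nCk+nC[k+1]≡[n+1]C[k+1] n k)

  absorption : ∀ n k → suc k * (suc n C suc k) ≡ suc n * (n C k)
  absorption zero    zero    = refl
  absorption zero    (suc k) = *-zeroʳ (suc (suc k))
  absorption (suc n) zero    rewrite nC1≡n (suc (suc n)) = *-comm 1 (suc (suc n))
  absorption (suc n) (suc k) = begin
    suc (suc k) * (suc (suc n) C suc (suc k))                   ≡⟨ cong (suc (suc k) *_) (pascal (suc n) (suc k)) ⟩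
    suc (suc k) * (suc n C suc k + suc n C suc (suc k))         ≡⟨ *-distribˡ-+ (suc (suc k)) (suc n C suc k) _ ⟩
    suc (suc k) * (suc n C suc k) + suc (suc k) * (suc n C suc (suc k))
                                                                ≡⟨ cong (suc (suc k) * (suc n C suc k) +_) (absorption n (suc k)) ⟩
    suc n C suc k + suc k * (suc n C suc k) + suc n * (n C suc k)
                                                                ≡⟨ cong (λ t → suc n C suc k + t + suc n * (n C suc k)) (absorption n k) ⟩
    suc n C suc k + suc n * (n C k) + suc n * (n C suc k)         ≡⟨ +-assoc (suc n C suc k) _ _ ⟩
    suc n C suc k + (suc n * (n C k) + suc n * (n C suc k))       ≡⟨ cong (suc n C suc k +_) (*-distribˡ-+ (suc n) (n C k) _) ⟨
    suc n C suc k + suc n * (n C k + n C suc k)                   ≡⟨ cong (λ t → suc n C suc k + suc n * t) (pascal n k) ⟨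
    suc n C suc k + suc n * (suc n C suc k)                       ∎
    where open ≡-Reasoning

  absorption′ : ∀ n k → suc k * (n C suc k) + k * (n C k) ≡ n * (n C k)
  absorption′ zero    zero    = refl
  absorption′ zero    (suc k) = cong₂ _+_ (*-zeroʳ (suc (suc k))) (*-zeroʳ (suc k))
  absorption′ (suc n) zero    rewrite absorption n 0 = +-identityʳ _
  absorption′ (suc n) (suc k) rewrite absorption n (suc k) | absorption n k | pascal n k =
    trans (+-comm (suc n * (n C suc k)) _) (sym (*-distribˡ-+ (suc n) (n C k) _))

  worpitzky-step : ∀ m a n → a ≤ n →
    suc a * ((m + a) C suc n) + (n ∸ a) * (suc (m + a) C suc n) ≡ m * ((m + a) C n)
  worpitzky-step m a n a≤n with m≤n⇒∃[o]m+o≡n a≤n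
  ... | d , refl rewrite m+n∸m≡n a d | pascal (m + a) (a + d) = +-cancelʳ-≡ (a * Y) _ _ (begin
    suc a * X + d * (Y + X) + a * Y   ≡⟨ regroup a d X Y ⟩
    suc (a + d) * X + (a + d) * Y     ≡⟨ absorption′ (m + a) (a + d) ⟩
    (m + a) * Y                       ≡⟨ *-distribʳ-+ Y m a ⟩
    m * Y + a * Y                     ∎)
    where
    open ≡-Reasoning
    X = (m + a) C suc (a + d)
    Y = (m + a) C (a + d)
    regroup : ∀ a d X Y → suc a * X + d * (Y + X) + a * Y ≡ suc (a + d) * X + (a + d) * Y
    regroup = solve-∀

  ascents-permsByInsertion : ∀ n {σ} → σ ∈ permsByInsertion n → ascents σ ≤ n
  ascents-permsByInsertion n {[]}    _  = z≤n
  ascents-permsByInsertion n {x ∷ σ} σ∈ with ∈-permsByInsertion⁻ n σ∈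
  ... | _ , refl , _ = m≤n⇒m≤1+n (ascents≤length x σ)

  worpitzky : ∀ n m → sum (map (λ σ → (m + ascents σ) C n) (permsByInsertion n)) ≡ m ^ n
  worpitzky zero    m = refl
  worpitzky (suc n) m = begin
    sum (map (λ τ → (m + ascents τ) C suc n) (concatMap (insertions n) (permsByInsertion n)))
      ≡⟨ sum-map-concatMap _ (insertions n) (permsByInsertion n) ⟩
    sum (map (λ σ → sum (map (λ τ → (m + ascents τ) C suc n) (insertions n σ))) (permsByInsertion n))
      ≡⟨ sum-map-cong (permsByInsertion n) insert ⟩
    sum (map (λ σ → m * ((m + ascents σ) C n)) (permsByInsertion n))
      ≡⟨ sum-map-*ˡ m _ (permsByInsertion n) ⟩
    m * sum (map (λ σ → (m + ascents σ) C n) (permsByInsertion n))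
      ≡⟨ cong (m *_) (worpitzky n m) ⟩
    m * m ^ n ∎
    where
    open ≡-Reasoning
    insert : ∀ {σ} → σ ∈ permsByInsertion n →
      sum (map (λ τ → (m + ascents τ) C suc n) (insertions n σ)) ≡ m * ((m + ascents σ) C n)
    insert {σ} σ∈ with ∈-permsByInsertion⁻ n σ∈
    ... | _ , len , σ<n rewrite insertions-ascents σ (λ a → (m + a) C suc n) σ<n | len | +-suc m (ascents σ) =
      worpitzky-step m (ascents σ) n (ascents-permsByInsertion n σ∈)


  worpitzky-cumulative : ∀ n j → sum (map (λ σ → (j + ascents σ) C suc n) (permsByInsertion n)) ≡ ∑ℕ j (_^ n)
  worpitzky-cumulative n zero    =
    sum-map-0 (permsByInsertion n) (λ σ∈ → k>n⇒nCk≡0 (s≤s (ascents-permsByInsertion n σ∈)))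
  worpitzky-cumulative n (suc j) = begin
    sum (map (λ σ → (suc j + ascents σ) C suc n) (permsByInsertion n))
      ≡⟨ sum-map-cong (permsByInsertion n) (λ {σ} _ → pascal (j + ascents σ) n) ⟩
    sum (map (λ σ → (j + ascents σ) C n + (j + ascents σ) C suc n) (permsByInsertion n))
      ≡⟨ sum-map-+ _ _ (permsByInsertion n) ⟩
    sum (map (λ σ → (j + ascents σ) C n) (permsByInsertion n)) + sum (map (λ σ → (j + ascents σ) C suc n) (permsByInsertion n))
      ≡⟨ cong₂ _+_ (worpitzky n j) (worpitzky-cumulative n j) ⟩
    j ^ n + ∑ℕ j (_^ n)
      ≡⟨ +-comm (j ^ n) _ ⟩
    ∑ℕ j (_^ n) + j ^ n ∎
    where open ≡-Reasoning

  indicator : Bool → ℕ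
  indicator b = if b then 1 else 0

  length-filter-T? : ∀ {A : Set} (b : A → Bool) xs → length (filter (T? ∘ b) xs) ≡ sum (map (indicator ∘ b) xs)
  length-filter-T? b []       = refl
  length-filter-T? b (x ∷ xs) with b x
  ... | true  = cong suc (length-filter-T? b xs)
  ... | false = length-filter-T? b xs

  eqList-refl : ∀ w → eqList w w ≡ true
  eqList-refl []      = refl
  eqList-refl (x ∷ w) rewrite eqList-refl w with x ≡ᵇ x in eq
  ... | true  = refl
  ... | false = ⊥-elim (subst T eq (≡⇒≡ᵇ x x refl))

  eqList-sound : ∀ u w → eqList u w ≡ true → u ≡ w
  eqList-sound []      []      _  = refl
  eqList-sound (x ∷ u) (y ∷ w) eq with x ≡ᵇ y in x≡ᵇy
  ... | true = cong₂ _∷_ (≡ᵇ⇒≡ x y (subst T (sym x≡ᵇy) _)) (eqList-sound u w eq)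

  eqList-≢ : ∀ {u w} → u ≢ w → eqList u w ≡ false
  eqList-≢ {u} {w} u≢w with eqList u w in eq
  ... | true  = ⊥-elim (u≢w (eqList-sound u w eq))
  ... | false = refl

  count-without : ∀ (b : List ℕ → Bool) {i} xs → Unique xs → i ∈ xs → b i ≡ true →
    suc (sum (map (λ w → indicator (b w ∧ not (eqList w i))) xs)) ≡ sum (map (indicator ∘ b) xs)
  count-without b {i} (i ∷ xs) (i∉xs ∷ _) (here refl) bi rewrite eqList-refl i | bi =
    cong suc (sum-map-cong xs (λ {w} w∈ → cong indicator
      (trans (cong (λ t → b w ∧ not t) (eqList-≢ (λ w≡i → All.lookup i∉xs w∈ (sym w≡i)))) (∧-identityʳ (b w)))))
  count-without b {i} (x ∷ xs) (x∉xs ∷ xs!) (there i∈) bi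
    rewrite eqList-≢ (λ x≡i → All.lookup x∉xs i∈ x≡i) | ∧-identityʳ (b x) | sym (count-without b xs xs! i∈ bi) =
    sym (+-suc (indicator (b x)) _)

  ascents-applyUpTo : ∀ (f : ℕ → ℕ) n → (∀ i → f i < f (suc i)) → ascents (applyUpTo f (suc n)) ≡ n
  ascents-applyUpTo f zero    _ = refl
  ascents-applyUpTo f (suc n) f↑ rewrite <⇒<ᵇ≡true (f↑ 0) = cong suc (ascents-applyUpTo (f ∘ suc) n (f↑ ∘ suc))

  identity∈permsByInsertion : ∀ n → identity n ∈ permsByInsertion n
  identity∈permsByInsertion n = ∈-permsByInsertion⁺ n (Unique.upTo⁺ n , length-upTo n , All.tabulate ∈-upTo⁻)

  isEvenAscents : List ℕ → Bool
  isEvenAscents = isEven ∘ ascents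

  evenAscentCount : ℕ → ℕ
  evenAscentCount n = sum (map (indicator ∘ isEvenAscents) (permsByInsertion n))

  suc-M≡evenAscentCount : ∀ n → isEvenAscents (identity n) ≡ true → suc (M n) ≡ evenAscentCount n
  suc-M≡evenAscentCount n idEven = begin
    suc (length (filter (T? ∘ b) (perms n)))
                                                            ≡⟨ cong suc (↭-length (filter-↭ (T? ∘ b) (perms↭permsByInsertion n))) ⟩
    suc (length (filter (T? ∘ b) (permsByInsertion n)))     ≡⟨ cong suc (length-filter-T? b (permsByInsertion n)) ⟩
    suc (sum (map (indicator ∘ b) (permsByInsertion n)))    ≡⟨ count-without isEvenAscents (permsByInsertion n)
                                                                 (permsByInsertion-unique n) (identity∈permsByInsertion n) idEven ⟩
    sum (map (indicator ∘ isEvenAscents) (permsByInsertion n)) ∎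
    where
    open ≡-Reasoning
    b : List ℕ → Bool
    b w = isEvenAscents w ∧ not (eqList w (identity n))

module Arithmetic where

  open import Algebra.Bundles using (AbelianGroup; CommutativeSemiring)
  import Algebra.Definitions.RawSemiring as RawSemiring
  import Algebra.Properties.CommutativeSemiring.Binomial as Binomial
  open import Data.Fin using (toℕ)
  open import Data.Integer using (ℤ; +_; -[1+_]; -_; _+_; _*_; _-_; _^_; -1ℤ; 0ℤ; 1ℤ; ∣_∣)
  import Data.Integer.Properties as ℤ
  open import Algebra.Properties.Group (AbelianGroup.group ℤ.+-0-abelianGroup) using () renaming (∙-cancelˡ to +-cancelˡ)
  open import Data.Integer.Properties
    using (pos-+; pos-*; +-injective; abs-*; -1*i≡-i; +-identityˡ; suc-*; ^-zeroˡ; *-identityʳ; +-*-commutativeSemiring)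
  import Data.Integer.Divisibility.Signed as Signed
  open import Data.Integer.Tactic.RingSolver using (solve-∀)
  open import Data.Nat as ℕ using (ℕ; zero; suc; _<_; _≤_; _∸_; z≤n; s≤s; NonZero)
  open import Data.Nat.Combinatorics using (_C_; nCn≡1; k>n⇒nCk≡0)
  open import Data.Nat.Divisibility using (_∣_; divides; ∣⇒≤; ∣-trans; n∣m*n)
  open import Data.Nat.DivMod using (_/_; _%_; m*[n/m]≡n; m*n%n≡0; [m+kn]%n≡m%n)
  open import Data.Nat.Primality using (Prime; euclidsLemma)
  import Data.Nat.Properties as ℕ
  open import Data.Nat.Tactic.RingSolver using () renaming (solve-∀ to ℕ-solve-∀)
  open import Level using (0ℓ)
  open import Relation.Binary using (IsEquivalence; Setoid)
  open import Relation.Binary.Definitions using (tri<; tri≈; tri>)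
  import Relation.Binary.Reasoning.Setoid as SetoidReasoning
  open import Relation.Nullary.Decidable using (dec-true; dec-false)

  open Combinatorics

  ∑ : ℕ → (ℕ → ℤ) → ℤ
  ∑ zero    f = 0ℤ
  ∑ (suc n) f = ∑ n f + f n

  pos-∑ℕ : ∀ n f → + ∑ℕ n f ≡ ∑ n (+_ ∘ f)
  pos-∑ℕ zero    f = refl
  pos-∑ℕ (suc n) f = trans (pos-+ (∑ℕ n f) (f n)) (cong (_+ + f n) (pos-∑ℕ n f))

  pos-^ : ∀ m k → + (m ℕ.^ k) ≡ (+ m) ^ k
  pos-^ m zero    = refl
  pos-^ m (suc k) = trans (pos-* m (m ℕ.^ k)) (cong (+ m *_) (pos-^ m k))

  ∑-cong : ∀ n {f g} → (∀ k → k < n → f k ≡ g k) → ∑ n f ≡ ∑ n g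
  ∑-cong zero    _   = refl
  ∑-cong (suc n) f≡g = cong₂ _+_ (∑-cong n (λ k k<n → f≡g k (ℕ.m<n⇒m<1+n k<n))) (f≡g n (ℕ.n<1+n n))

  ∑-0 : ∀ n → ∑ n (λ _ → 0ℤ) ≡ 0ℤ
  ∑-0 zero    = refl
  ∑-0 (suc n) = cong (_+ 0ℤ) (∑-0 n)

  ∑-+ : ∀ n f g → ∑ n (λ k → f k + g k) ≡ ∑ n f + ∑ n g
  ∑-+ zero    f g = refl
  ∑-+ (suc n) f g rewrite ∑-+ n f g = +-+-comm (∑ n f) (∑ n g) (f n) (g n)
    where
    +-+-comm : ∀ a b c d → a + b + (c + d) ≡ a + c + (b + d)
    +-+-comm = solve-∀

  ∑-*ˡ : ∀ n c f → ∑ n (λ k → c * f k) ≡ c * ∑ n f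
  ∑-*ˡ zero    c f = sym (ℤ.*-zeroʳ c)
  ∑-*ˡ (suc n) c f rewrite ∑-*ˡ n c f = sym (ℤ.*-distribˡ-+ c (∑ n f) (f n))

  ∑-neg : ∀ n f → ∑ n (λ k → - f k) ≡ - ∑ n f
  ∑-neg zero    f = refl
  ∑-neg (suc n) f rewrite ∑-neg n f = sym (ℤ.neg-distrib-+ (∑ n f) (f n))

  ∑-const : ∀ n c → ∑ n (λ _ → c) ≡ + n * c
  ∑-const zero    c = refl
  ∑-const (suc n) c rewrite ∑-const n c = step (+ n) c
    where
    step : ∀ m c → m * c + c ≡ (1ℤ + m) * c
    step = solve-∀

  ∑-shift : ∀ n f → ∑ (suc n) f ≡ f 0 + ∑ n (f ∘ suc)
  ∑-shift zero    f = ℤ.+-comm 0ℤ (f 0)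
  ∑-shift (suc n) f rewrite ∑-shift n f = ℤ.+-assoc (f 0) (∑ n (f ∘ suc)) (f (suc n))

  ∑-pairs : ∀ m f → ∑ (2 ℕ.* m) f ≡ ∑ m (λ j → f (2 ℕ.* j) + f (suc (2 ℕ.* j)))
  ∑-pairs zero    f = refl
  ∑-pairs (suc m) f = begin
    ∑ (2 ℕ.* suc m) f                                  ≡⟨ cong (λ k → ∑ k f) (ℕ.*-suc 2 m) ⟩
    ∑ (2 ℕ.* m) f + f (2 ℕ.* m) + f (suc (2 ℕ.* m))    ≡⟨ cong (λ t → t + f (2 ℕ.* m) + f (suc (2 ℕ.* m))) (∑-pairs m f) ⟩
    ∑ m g + f (2 ℕ.* m) + f (suc (2 ℕ.* m))            ≡⟨ ℤ.+-assoc (∑ m g) _ _ ⟩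
    ∑ m g + g m                                        ∎
    where
    open ≡-Reasoning
    g = λ j → f (2 ℕ.* j) + f (suc (2 ℕ.* j))

  ∑-reverse : ∀ n f → ∑ n f ≡ ∑ n (λ j → f (n ∸ suc j))
  ∑-reverse zero    f = refl
  ∑-reverse (suc n) f = begin
    ∑ n f + f n                              ≡⟨ cong (_+ f n) (∑-reverse n f) ⟩
    ∑ n (λ j → f (n ∸ suc j)) + f n          ≡⟨ ℤ.+-comm _ (f n) ⟩
    f n + ∑ n (λ j → f (n ∸ suc j))          ≡⟨ ∑-shift n (λ j → f (suc n ∸ suc j)) ⟨
    ∑ (suc n) (λ j → f (suc n ∸ suc j))      ∎
    where open ≡-Reasoning

  ∑-triangle : ∀ n g → ∑ n (λ i → ∑ (suc i) g) ≡ ∑ n (λ j → (+ n - + j) * g j)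
  ∑-triangle zero    g = refl
  ∑-triangle (suc n) g = begin
    ∑ n (λ i → ∑ (suc i) g) + (∑ n g + g n)                     ≡⟨ cong (_+ (∑ n g + g n)) (∑-triangle n g) ⟩
    ∑ n (λ j → (+ n - + j) * g j) + (∑ n g + g n)
                                                                ≡⟨ regroup (∑ n (λ j → (+ n - + j) * g j)) (∑ n g) (g n) (+ n) ⟩
    (∑ n (λ j → (+ n - + j) * g j) + ∑ n g) + (1ℤ + + n - + n) * g n
                                                                ≡⟨ cong (_+ (1ℤ + + n - + n) * g n) (∑-+ n _ g) ⟨
    ∑ n (λ j → (+ n - + j) * g j + g j) + (1ℤ + + n - + n) * g n
                                                                ≡⟨ cong (_+ (1ℤ + + n - + n) * g n) (∑-cong n (λ j _ → widen (+ n) (+ j) (g j))) ⟩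
    ∑ n (λ j → (1ℤ + + n - + j) * g j) + (1ℤ + + n - + n) * g n ∎
    where
    open ≡-Reasoning
    regroup : ∀ a b c m → a + (b + c) ≡ (a + b) + (1ℤ + m - m) * c
    regroup = solve-∀
    widen : ∀ m j x → (m - j) * x + x ≡ (1ℤ + m - j) * x
    widen = solve-∀

  private
    module ℤ-Semiring = CommutativeSemiring +-*-commutativeSemiring
    open RawSemiring ℤ-Semiring.rawSemiring using () renaming (_^_ to _^ᴿ_; _×_ to _×ᴿ_; sum to sumᴿ)

  ^ᴿ≡^ : ∀ x n → x ^ᴿ n ≡ x ^ n
  ^ᴿ≡^ x zero    = refl
  ^ᴿ≡^ x (suc n) = cong (x *_) (^ᴿ≡^ x n)

  ×ᴿ≡* : ∀ n x → n ×ᴿ x ≡ + n * x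
  ×ᴿ≡* zero    x = refl
  ×ᴿ≡* (suc n) x = trans (cong (_+_ x) (×ᴿ≡* n x)) (sym (suc-* (+ n) x))

  sumᴿ≡∑ : ∀ n (f : ℕ → ℤ) → sumᴿ (f ∘ toℕ {n}) ≡ ∑ n f
  sumᴿ≡∑ zero    f = refl
  sumᴿ≡∑ (suc n) f = trans (cong (_+_ (f 0)) (sumᴿ≡∑ n (f ∘ suc))) (sym (∑-shift n f))

  binomial-theorem : ∀ n x → (x + 1ℤ) ^ n ≡ ∑ (suc n) (λ k → + (n C k) * x ^ k)
  binomial-theorem n x = begin
    (x + 1ℤ) ^ n ≡⟨ ^ᴿ≡^ (x + 1ℤ) n ⟨
    (x + 1ℤ) ^ᴿ n ≡⟨ Binomial.theorem +-*-commutativeSemiring n x 1ℤ ⟩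
    sumᴿ {suc n} (term ∘ toℕ) ≡⟨ sumᴿ≡∑ (suc n) term ⟩
    ∑ (suc n) term ≡⟨ ∑-cong (suc n) (λ k _ → simplify k) ⟩
    ∑ (suc n) (λ k → + (n C k) * x ^ k) ∎
    where
    open ≡-Reasoning
    term : ℕ → ℤ
    term k = (n C k) ×ᴿ (x ^ᴿ k * 1ℤ ^ᴿ (n ∸ k))
    simplify : ∀ k → term k ≡ + (n C k) * x ^ k
    simplify k rewrite ×ᴿ≡* (n C k) (x ^ᴿ k * 1ℤ ^ᴿ (n ∸ k)) | ^ᴿ≡^ x k | ^ᴿ≡^ 1ℤ (n ∸ k) | ^-zeroˡ (n ∸ k) =
      cong (+ (n C k) *_) (*-identityʳ (x ^ k))

  module Congruence (n : ℕ) where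

    infix 4 _≈_
    record _≈_ (a b : ℤ) : Set where
      constructor mk≈
      field
        quotient : ℤ
        equation : a ≡ b + quotient * + n

    private
      N = + n
      refl-form : ∀ a p → a ≡ a + 0ℤ * p
      refl-form = solve-∀
      sym-form : ∀ b c p → b ≡ (b + c * p) + (- c) * p
      sym-form = solve-∀
      trans-form : ∀ c x y p → (c + y * p) + x * p ≡ c + (y + x) * p
      trans-form = solve-∀
      +-form : ∀ b d x y p → (b + x * p) + (d + y * p) ≡ (b + d) + (x + y) * p
      +-form = solve-∀
      *-form : ∀ b d x y p → (b + x * p) * (d + y * p) ≡ b * d + (x * d + b * y + x * y * p) * p
      *-form = solve-∀
      neg-form : ∀ b x p → - (b + x * p) ≡ - b + (- x) * p
      neg-form = solve-∀

    ≈-reflexive : ∀ {a b} → a ≡ b → a ≈ b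
    ≈-reflexive {a} refl = mk≈ 0ℤ (refl-form a N)

    ≈-refl : ∀ {a} → a ≈ a
    ≈-refl = ≈-reflexive refl

    ≈-sym : ∀ {a b} → a ≈ b → b ≈ a
    ≈-sym {b = b} (mk≈ c refl) = mk≈ (- c) (sym-form b c N)

    ≈-trans : ∀ {a b c} → a ≈ b → b ≈ c → a ≈ c
    ≈-trans {c = c} (mk≈ x refl) (mk≈ y refl) = mk≈ (y + x) (trans-form c x y N)

    ≈-isEquivalence : IsEquivalence _≈_
    ≈-isEquivalence = record { refl = ≈-refl ; sym = ≈-sym ; trans = ≈-trans }

    ≈-setoid : Setoid 0ℓ 0ℓ
    ≈-setoid = record { isEquivalence = ≈-isEquivalence }

    +-cong : ∀ {a b c d} → a ≈ b → c ≈ d → a + c ≈ b + d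
    +-cong {b = b} {d = d} (mk≈ x refl) (mk≈ y refl) = mk≈ (x + y) (+-form b d x y N)

    *-cong : ∀ {a b c d} → a ≈ b → c ≈ d → a * c ≈ b * d
    *-cong {b = b} {d = d} (mk≈ x refl) (mk≈ y refl) = mk≈ (x * d + b * y + x * y * N) (*-form b d x y N)

    -‿cong : ∀ {a b} → a ≈ b → - a ≈ - b
    -‿cong {b = b} (mk≈ x refl) = mk≈ (- x) (neg-form b x N)

    ^-cong : ∀ {a b} k → a ≈ b → a ^ k ≈ b ^ k
    ^-cong zero    _   = ≈-refl
    ^-cong (suc k) a≈b = *-cong a≈b (^-cong k a≈b)

    ∣⇒≈0 : ∀ {x} → n ∣ x → + x ≈ 0ℤ
    ∣⇒≈0 {x} (divides c refl) = mk≈ (+ c) (trans (pos-* c n) (sym (+-identityˡ _)))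

    ≈0⇒∣ : ∀ {x} → + x ≈ 0ℤ → n ∣ x
    ≈0⇒∣ {x} (mk≈ c eq) = Signed.∣⇒∣ᵤ (Signed.divides c (trans eq (+-identityˡ _)))

    ≈⇒%≡ : ∀ {x y} .{{_ : NonZero n}} → + x ≈ + y → x % n ≡ y % n
    ≈⇒%≡ {x} {y} (mk≈ (+ c) eq) = begin
      x % n             ≡⟨ cong (_% n) (+-injective (trans eq (cong (_+_ (+ y)) (sym (pos-* c n))))) ⟩
      (y ℕ.+ c ℕ.* n) % n ≡⟨ [m+kn]%n≡m%n y c n ⟩
      y % n             ∎
      where open ≡-Reasoning
    ≈⇒%≡ {x} {y} (mk≈ -[1+ c ] eq) = sym (begin
      y % n                   ≡⟨ cong (_% n) (+-injective (trans (move (+ y) -[1+ c ] eq) (cong (_+_ (+ x)) (sym (pos-* (suc c) n))))) ⟩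
      (x ℕ.+ suc c ℕ.* n) % n ≡⟨ [m+kn]%n≡m%n x (suc c) n ⟩
      x % n                   ∎)
      where
      open ≡-Reasoning
      move : ∀ {a} b c → a ≡ b + c * N → b ≡ a + (- c) * N
      move b c refl = sym-form b c N

    ∑-cong≈ : ∀ m {f g} → (∀ k → k < m → f k ≈ g k) → ∑ m f ≈ ∑ m g
    ∑-cong≈ zero    _   = ≈-refl
    ∑-cong≈ (suc m) f≈g = +-cong (∑-cong≈ m (λ k k<m → f≈g k (ℕ.m<n⇒m<1+n k<m))) (f≈g m (ℕ.n<1+n m))

    sum-map-cong≈ : ∀ {A : Set} {f g : A → ℕ} xs → (∀ {x} → x ∈ xs → + f x ≈ + g x) →
      + sum (map f xs) ≈ + sum (map g xs)
    sum-map-cong≈ []               _   = ≈-refl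
    sum-map-cong≈ {f = f} {g} (x ∷ xs) f≈g =
      ≈-trans (≈-reflexive (pos-+ (f x) _))
        (≈-trans (+-cong (f≈g (here refl)) (sum-map-cong≈ xs (f≈g ∘ there))) (≈-reflexive (sym (pos-+ (g x) _))))

    cancelˡ : Prime n → ∀ k {a b} → ¬ n ∣ ∣ k ∣ → k * a ≈ k * b → a ≈ b
    cancelˡ n-prime k {a} {b} n∤k (mk≈ c eq) with euclidsLemma ∣ k ∣ ∣ a - b ∣ n-prime n∣k[a-b]
      where
      n∣k[a-b] : n ∣ ∣ k ∣ ℕ.* ∣ a - b ∣
      n∣k[a-b] = subst (n ∣_) (abs-* k (a - b)) (Signed.∣⇒∣ᵤ (Signed.divides c (factor eq)))
        where
        factor : k * a ≡ k * b + c * N → k * (a - b) ≡ c * N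
        factor eq = trans (distrib k a b) (trans (cong (_- k * b) eq) (cancel (k * b) (c * N)))
          where
          distrib : ∀ k a b → k * (a - b) ≡ k * a - k * b
          distrib = solve-∀
          cancel : ∀ x y → (x + y) - x ≡ y
          cancel = solve-∀
    ... | inj₁ n∣k   = contradiction n∣k n∤k
    ... | inj₂ n∣a-b with Signed.∣ᵤ⇒∣ {+ n} {a - b} n∣a-b
    ... | Signed.divides q a-b≡qn = mk≈ q (trans (split a b) (cong (_+_ b) a-b≡qn))
      where
      split : ∀ a b → a ≡ b + (a - b)
      split = solve-∀

  δ : ℕ → ℕ → ℤ
  δ m n = if does (m ℕ.≟ n) then 1ℤ else 0ℤ

  δ-≡ : ∀ {m n} → m ≡ n → δ m n ≡ 1ℤ
  δ-≡ {m} {n} m≡n rewrite dec-true (m ℕ.≟ n) m≡n = refl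

  δ-≢ : ∀ {m n} → m ≢ n → δ m n ≡ 0ℤ
  δ-≢ {m} {n} m≢n rewrite dec-false (m ℕ.≟ n) m≢n = refl

  module Modulo (n : ℕ) (p-prime : Prime (2 ℕ.+ n)) where

    p : ℕ
    p = 2 ℕ.+ n

    open Congruence p public

    inverse : ℕ → ℤ
    inverse m = (+ m) ^ n

    prime∤ : ∀ {m} → 0 < m → m < p → ¬ p ∣ m
    prime∤ {suc m} _ m<p p∣m = ℕ.<⇒≱ m<p (∣⇒≤ p∣m)

    prime∣C : ∀ {k} → 0 < k → k < p → p ∣ p C k
    prime∣C {suc k} _ k<p
      with euclidsLemma (suc k) (p C suc k) p-prime (divides (suc n C k) (trans (absorption (suc n) k) (ℕ.*-comm p (suc n C k))))
    ... | inj₁ p∣k   = contradiction p∣k (prime∤ (s≤s z≤n) k<p)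
    ... | inj₂ p∣pCk = p∣pCk

    prime∣C-above : ∀ t {k} → t < k → k < p → p ∣ (p ℕ.+ t) C k
    prime∣C-above zero    {k}     0<k k<p = subst (λ N → p ∣ N C k) (sym (ℕ.+-identityʳ p)) (prime∣C 0<k k<p)
    prime∣C-above (suc t) {suc k} (s≤s t<k) k<p
      with euclidsLemma (suc k) (suc (p ℕ.+ t) C suc k) p-prime
             (subst (p ∣_) (sym (absorption (p ℕ.+ t) k))
               (∣-trans (prime∣C-above t t<k (ℕ.<-trans (ℕ.n<1+n k) k<p)) (n∣m*n (suc (p ℕ.+ t)))))
    ... | inj₁ p∣k = contradiction p∣k (prime∤ (s≤s z≤n) k<p)
    ... | inj₂ p∣C = subst (λ N → p ∣ N C suc k) (sym (ℕ.+-suc p t)) p∣C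

    C≈δ : ∀ N → N < p ℕ.+ suc n → + (N C suc n) ≈ δ N (suc n)
    C≈δ N N<2p-1 with ℕ.<-cmp N (suc n)
    ... | tri< N<p-1 N≢p-1 _ = ≈-reflexive (trans (cong +_ (k>n⇒nCk≡0 N<p-1)) (sym (δ-≢ N≢p-1)))
    ... | tri≈ _ refl _      = ≈-reflexive (trans (cong +_ (nCn≡1 N)) (sym (δ-≡ (refl {x = N}))))
    ... | tri> _ N≢p-1 N≥p with ℕ.m≤n⇒∃[o]m+o≡n N≥p
    ... | t , refl = ≈-trans (∣⇒≈0 (prime∣C-above t (ℕ.+-cancelˡ-< p t (suc n) N<2p-1) (ℕ.n<1+n (suc n))))
                             (≈-reflexive (sym (δ-≢ N≢p-1)))

    freshman's-dream : ∀ x → (x + 1ℤ) ^ p ≈ x ^ p + 1ℤ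
    freshman's-dream x = begin
      (x + 1ℤ) ^ p                                             ≡⟨ binomial-theorem p x ⟩
      ∑ (suc p) term                                           ≡⟨ cong (_+ term p) (∑-shift (suc n) term) ⟩
      1ℤ + ∑ (suc n) (term ∘ suc) + term p                     ≈⟨ +-cong (+-cong (≈-refl {1ℤ}) middle≈0) (≈-refl {term p}) ⟩
      1ℤ + 0ℤ + term p                                         ≡⟨ cong (λ c → 1ℤ + 0ℤ + + c * x ^ p) (nCn≡1 p) ⟩
      1ℤ + 0ℤ + 1ℤ * x ^ p                                     ≡⟨ tidy (x ^ p) ⟩
      x ^ p + 1ℤ                                               ∎
      where
      open SetoidReasoning ≈-setoid
      term : ℕ → ℤ
      term k = + (p C k) * x ^ k
      middle≈0 : ∑ (suc n) (term ∘ suc) ≈ 0ℤ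
      middle≈0 = ≈-trans (∑-cong≈ (suc n) (λ k k<p-1 → *-cong (∣⇒≈0 (prime∣C (s≤s z≤n) (s≤s k<p-1))) ≈-refl))
                         (≈-reflexive (∑-0 (suc n)))
      tidy : ∀ y → 1ℤ + 0ℤ + 1ℤ * y ≡ y + 1ℤ
      tidy = solve-∀

    fermat : ∀ a → (+ a) ^ p ≈ + a
    fermat zero    = ≈-refl
    fermat (suc a) = begin
      (+ suc a) ^ p          ≡⟨ cong (_^ p) (ℤ.+-comm 1ℤ (+ a)) ⟩
      (+ a + 1ℤ) ^ p         ≈⟨ freshman's-dream (+ a) ⟩
      (+ a) ^ p + 1ℤ         ≈⟨ +-cong (fermat a) ≈-refl ⟩
      + a + 1ℤ               ≡⟨ ℤ.+-comm (+ a) 1ℤ ⟩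
      + suc a                ∎
      where open SetoidReasoning ≈-setoid

    inverse-correct : ∀ {m} → 0 < m → m < p → + m * inverse m ≈ 1ℤ
    inverse-correct {m} 0<m m<p = cancelˡ p-prime (+ m) (prime∤ 0<m m<p)
      (≈-trans (fermat m) (≈-reflexive (sym (ℤ.*-identityʳ (+ m)))))

    C[p-1]≈±1 : ∀ j → j < p → + (suc n C j) ≈ -1ℤ ^ j
    C[p-1]≈±1 zero    _   = ≈-refl
    C[p-1]≈±1 (suc j) j<p = begin
      + (suc n C suc j)                               ≡⟨ isolate (+ (suc n C j)) (+ (suc n C suc j)) ⟩
      + (suc n C j) + + (suc n C suc j) - + (suc n C j) ≡⟨ cong (_- + (suc n C j)) (pos-+ (suc n C j) _) ⟨
      + (suc n C j ℕ.+ suc n C suc j) - + (suc n C j) ≡⟨ cong (λ c → + c - + (suc n C j)) (pascal (suc n) j) ⟨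
      + (p C suc j) - + (suc n C j)                   ≈⟨ +-cong (∣⇒≈0 (prime∣C (s≤s z≤n) j<p))
                                                                (-‿cong (C[p-1]≈±1 j (ℕ.<-trans (ℕ.n<1+n j) j<p))) ⟩
      0ℤ - -1ℤ ^ j                                    ≡⟨ ℤ.+-identityˡ _ ⟩
      - (-1ℤ ^ j)                                     ≡⟨ -1*i≡-i _ ⟨
      -1ℤ ^ suc j                                     ∎
      where
      open SetoidReasoning ≈-setoid
      isolate : ∀ a b → b ≡ a + b - a
      isolate = solve-∀

    binomial-quotient-exact : ∀ {k} → k < suc n → suc k ℕ.* ((p C suc k) / p) ≡ suc n C k
    binomial-quotient-exact {k} k<p-1 = ℕ.*-cancelˡ-≡ _ _ p (begin
      p ℕ.* (suc k ℕ.* c)    ≡⟨ swap p (suc k) c ⟩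
      suc k ℕ.* (p ℕ.* c)    ≡⟨ cong (suc k ℕ.*_) (m*[n/m]≡n (prime∣C (s≤s z≤n) (s≤s k<p-1))) ⟩
      suc k ℕ.* (p C suc k)  ≡⟨ absorption (suc n) k ⟩
      p ℕ.* (suc n C k)      ∎)
      where
      open ≡-Reasoning
      c = (p C suc k) / p
      swap : ∀ a b c → a ℕ.* (b ℕ.* c) ≡ b ℕ.* (a ℕ.* c)
      swap = ℕ-solve-∀

    binomial-quotient : ∀ {k} → k < suc n → + ((p C suc k) / p) ≈ -1ℤ ^ k * inverse (suc k)
    binomial-quotient {k} k<p-1 = begin
      + c                                      ≡⟨ ℤ.*-identityʳ (+ c) ⟨
      + c * 1ℤ                                 ≈⟨ *-cong (≈-refl {+ c}) (inverse-correct (s≤s z≤n) (s≤s k<p-1)) ⟨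
      + c * (+ suc k * inverse (suc k))        ≡⟨ regroup (+ c) (+ suc k) (inverse (suc k)) ⟩
      + suc k * + c * inverse (suc k)          ≡⟨ cong (_* inverse (suc k)) (trans (sym (pos-* (suc k) c)) (cong +_ k*c≡C)) ⟩
      + (suc n C k) * inverse (suc k)          ≈⟨ *-cong (C[p-1]≈±1 k (ℕ.m<n⇒m<1+n k<p-1)) (≈-refl {inverse (suc k)}) ⟩
      -1ℤ ^ k * inverse (suc k)                ∎
      where
      open SetoidReasoning ≈-setoid
      c = (p C suc k) / p
      k*c≡C = binomial-quotient-exact k<p-1
      regroup : ∀ c m i → c * (m * i) ≡ m * c * i
      regroup = solve-∀

  parity : ∀ a → ∃[ e ] (a ≡ 2 ℕ.* e ⊎ a ≡ suc (2 ℕ.* e))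
  parity zero = 0 , inj₁ refl
  parity (suc a) with parity a
  ... | e , inj₁ refl = e , inj₂ refl
  ... | e , inj₂ refl = suc e , inj₁ (sym (ℕ.*-suc 2 e))

  isEven-even : ∀ e → isEven (2 ℕ.* e) ≡ true
  isEven-even e = cong (ℕ._≡ᵇ 0) (trans (cong (_% 2) (ℕ.*-comm 2 e)) (m*n%n≡0 e 2))

  isEven-odd : ∀ e → isEven (suc (2 ℕ.* e)) ≡ false
  isEven-odd e = cong (ℕ._≡ᵇ 0) (trans (cong (λ t → suc t % 2) (ℕ.*-comm 2 e)) ([m+kn]%n≡m%n 1 e 2))

  δ-cong : ∀ {x y u v} → (x ≡ y → u ≡ v) → (u ≡ v → x ≡ y) → δ x y ≡ δ u v
  δ-cong {x} {y} ⇒ ⇐ with x ℕ.≟ y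
  ... | yes x≡y = trans (δ-≡ x≡y) (sym (δ-≡ (⇒ x≡y)))
  ... | no x≢y  = trans (δ-≢ x≢y) (sym (δ-≢ (x≢y ∘ ⇐)))

  ∑-δ : ∀ m {i₀} → i₀ < m → ∑ m (λ i → δ i i₀) ≡ 1ℤ
  ∑-δ (suc m) {i₀} i₀<1+m with ℕ.m≤n⇒m<n∨m≡n (ℕ.≤-pred i₀<1+m)
  ... | inj₁ i₀<m  rewrite ∑-δ m i₀<m | δ-≢ (ℕ.>⇒≢ i₀<m) = refl
  ... | inj₂ refl  rewrite ∑-cong m (λ i i<m → δ-≢ (ℕ.<⇒≢ i<m)) | ∑-0 m | δ-≡ (refl {x = m}) = refl

  even-hits : ∀ m a → a ≤ suc (2 ℕ.* m) →
    ∑ (suc m) (λ i → δ (2 ℕ.* suc i ℕ.+ a) (2 ℕ.* suc m)) ≡ + indicator (isEven a)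
  even-hits m a a≤ with parity a
  ... | e , inj₂ refl rewrite isEven-odd e = trans (∑-cong (suc m) (λ i _ → δ-≢ (odd≢even i))) (∑-0 (suc m))
    where
    odd≢even : ∀ i → 2 ℕ.* suc i ℕ.+ suc (2 ℕ.* e) ≢ 2 ℕ.* suc m
    odd≢even i eq = ℕ.even≢odd (suc m) (suc i ℕ.+ e) (trans (sym eq) (regroup i e))
      where
      regroup : ∀ i e → 2 ℕ.* suc i ℕ.+ suc (2 ℕ.* e) ≡ suc (2 ℕ.* (suc i ℕ.+ e))
      regroup = ℕ-solve-∀
  ... | e , inj₁ refl rewrite isEven-even e =
    trans (∑-cong (suc m) (λ i _ → δ-cong (hit⇒ i) (⇒hit i))) (∑-δ (suc m) (s≤s (ℕ.m∸n≤m m e)))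
    where
    e≤m : e ≤ m
    e≤m = ℕ.≤-pred (ℕ.*-cancelˡ-< 2 e (suc m) (subst (2 ℕ.* e <_) (sym (ℕ.*-suc 2 m)) (s≤s a≤)))
    halve : ∀ i → 2 ℕ.* suc i ℕ.+ 2 ℕ.* e ≡ 2 ℕ.* suc m → i ℕ.+ e ≡ m
    halve i eq = ℕ.suc-injective (ℕ.*-cancelˡ-≡ (suc i ℕ.+ e) (suc m) 2 (trans (ℕ.*-distribˡ-+ 2 (suc i) e) eq))
    hit⇒ : ∀ i → 2 ℕ.* suc i ℕ.+ 2 ℕ.* e ≡ 2 ℕ.* suc m → i ≡ m ℕ.∸ e
    hit⇒ i eq = trans (sym (ℕ.m+n∸n≡m i e)) (cong (ℕ._∸ e) (halve i eq))
    ⇒hit : ∀ i → i ≡ m ℕ.∸ e → 2 ℕ.* suc i ℕ.+ 2 ℕ.* e ≡ 2 ℕ.* suc m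
    ⇒hit i refl = trans (sym (ℕ.*-distribˡ-+ 2 (suc (m ℕ.∸ e)) e)) (cong (λ t → 2 ℕ.* suc t) (ℕ.m∸n+n≡m e≤m))

  neg-^ : ∀ a k → (- a) ^ k ≡ -1ℤ ^ k * a ^ k
  neg-^ a zero    = refl
  neg-^ a (suc k) rewrite neg-^ a k = regroup a (-1ℤ ^ k) (a ^ k)
    where
    regroup : ∀ a s b → - a * (s * b) ≡ -1ℤ * s * (a * b)
    regroup = solve-∀

  -1^even : ∀ j → -1ℤ ^ (2 ℕ.* j) ≡ 1ℤ
  -1^even zero    = refl
  -1^even (suc j) = trans (cong (-1ℤ ^_) (ℕ.*-suc 2 j)) (cong (λ t → -1ℤ * (-1ℤ * t)) (-1^even j))

  module OddPrime (K : ℕ) (p-prime : Prime (3 ℕ.+ 2 ℕ.* K)) where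

    n : ℕ
    n = suc (2 ℕ.* K)

    open Modulo n p-prime

    inverse-reflect : ∀ {x y} → x ℕ.+ y ≡ p → inverse x ≈ - inverse y
    inverse-reflect {x} {y} x+y≡p = begin
      (+ x) ^ n                                 ≈⟨ ^-cong (n) x≈-y ⟩
      (- + y) ^ n                               ≡⟨ neg-^ (+ y) n ⟩
      -1ℤ * -1ℤ ^ (2 ℕ.* K) * inverse y           ≡⟨ cong (λ s → -1ℤ * s * inverse y) (-1^even K) ⟩
      -1ℤ * 1ℤ * inverse y                        ≡⟨ ℤ.-1*i≡-i (inverse y) ⟩
      - inverse y                                 ∎
      where
      open SetoidReasoning ≈-setoid
      x≈-y : + x ≈ - + y
      x≈-y = mk≈ 1ℤ (trans (shift (+ x) (+ y)) (cong (λ t → - + y + 1ℤ * t) (trans (sym (ℤ.pos-+ x y)) (cong +_ x+y≡p))))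
        where
        shift : ∀ a b → a ≡ - b + 1ℤ * (a + b)
        shift = solve-∀

    q : ℕ
    q = (2 ℕ.^ (p ℕ.∸ 1) ℕ.∸ 1) / p

    prime∣2^[p-1]-1 : p ∣ 2 ℕ.^ (p ℕ.∸ 1) ℕ.∸ 1
    prime∣2^[p-1]-1 = ≈0⇒∣ (begin
      + t                        ≡⟨ trans (cong (_- 1ℤ) (ℤ.pos-+ t 1)) (+1-1 (+ t)) ⟨
      + (t ℕ.+ 1) - 1ℤ           ≡⟨ cong (λ u → + u - 1ℤ) (ℕ.m∸n+n≡m (ℕ.m^n>0 2 (p ℕ.∸ 1))) ⟩
      + (2 ℕ.^ (p ℕ.∸ 1)) - 1ℤ   ≡⟨ cong (_- 1ℤ) (pos-^ 2 (p ℕ.∸ 1)) ⟩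
      + 2 * inverse 2 - 1ℤ       ≈⟨ +-cong (inverse-correct (s≤s z≤n) (s≤s (s≤s (s≤s z≤n)))) ≈-refl ⟩
      1ℤ - 1ℤ                    ≡⟨⟩
      0ℤ                         ∎)
      where
      open SetoidReasoning ≈-setoid
      t = 2 ℕ.^ (p ℕ.∸ 1) ℕ.∸ 1
      +1-1 : ∀ a → a + 1ℤ - 1ℤ ≡ a
      +1-1 = solve-∀

    2^p≡2+p*2q : 2 ℕ.^ p ≡ 2 ℕ.+ p ℕ.* (2 ℕ.* q)
    2^p≡2+p*2q = begin
      2 ℕ.* 2 ℕ.^ (p ℕ.∸ 1)              ≡⟨ cong (2 ℕ.*_) (ℕ.m∸n+n≡m (ℕ.m^n>0 2 (p ℕ.∸ 1))) ⟨
      2 ℕ.* (t ℕ.+ 1)                    ≡⟨ cong (λ u → 2 ℕ.* (u ℕ.+ 1)) (m*[n/m]≡n prime∣2^[p-1]-1) ⟨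
      2 ℕ.* (p ℕ.* q ℕ.+ 1)              ≡⟨ regroup p q ⟩
      2 ℕ.+ p ℕ.* (2 ℕ.* q)              ∎
      where
      open ≡-Reasoning
      t = 2 ℕ.^ (p ℕ.∸ 1) ℕ.∸ 1
      regroup : ∀ p q → 2 ℕ.* (p ℕ.* q ℕ.+ 1) ≡ 2 ℕ.+ p ℕ.* (2 ℕ.* q)
      regroup = ℕ-solve-∀

    two-q-exact : + (2 ℕ.* q) ≡ ∑ (suc n) (λ k → + ((p C suc k) / p))
    two-q-exact = ℤ.*-cancelˡ-≡ (+ p) _ _ (+-cancelˡ (+ 2) _ _ (begin
      (+ 2) + + p * + (2 ℕ.* q)                       ≡⟨ cong (_+_ (+ 2)) (ℤ.pos-* p (2 ℕ.* q)) ⟨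
      + (2 ℕ.+ p ℕ.* (2 ℕ.* q))                    ≡⟨ cong +_ 2^p≡2+p*2q ⟨
      + (2 ℕ.^ p)                                  ≡⟨ pos-^ 2 p ⟩
      (1ℤ + 1ℤ) ^ p                                ≡⟨ binomial-theorem p 1ℤ ⟩
      ∑ (suc p) term                               ≡⟨ cong (_+ term p) (∑-shift (suc n) term) ⟩
      1ℤ + ∑ (suc n) (term ∘ suc) + term p
                                                   ≡⟨ cong₂ (λ s t → 1ℤ + s + t)
                                                        (trans (∑-cong (suc n) (λ _ → middle)) (∑-*ˡ (suc n) (+ p) (λ k → + ((p C suc k) / p))))
                                                        last ⟩
      1ℤ + + p * ∑ (suc n) (λ k → + ((p C suc k) / p)) + 1ℤ
                                                   ≡⟨ regroup (+ p * ∑ (suc n) (λ k → + ((p C suc k) / p))) ⟩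
      (+ 2) + + p * ∑ (suc n) (λ k → + ((p C suc k) / p)) ∎))
      where
      open ≡-Reasoning
      term : ℕ → ℤ
      term k = + (p C k) * 1ℤ ^ k
      middle : ∀ {k} → k < suc n → term (suc k) ≡ + p * + ((p C suc k) / p)
      middle {k} k<p-1 = begin
        + (p C suc k) * 1ℤ ^ suc k          ≡⟨ cong (+ (p C suc k) *_) (ℤ.^-zeroˡ (suc k)) ⟩
        + (p C suc k) * 1ℤ                  ≡⟨ ℤ.*-identityʳ (+ (p C suc k)) ⟩
        + (p C suc k)                       ≡⟨ cong +_ (m*[n/m]≡n (prime∣C (s≤s z≤n) (s≤s k<p-1))) ⟨
        + (p ℕ.* ((p C suc k) / p))         ≡⟨ ℤ.pos-* p ((p C suc k) / p) ⟩
        + p * + ((p C suc k) / p)           ∎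
      last : term p ≡ 1ℤ
      last = cong₂ (λ c u → + c * u) (nCn≡1 p) (ℤ.^-zeroˡ p)
      regroup : ∀ a → 1ℤ + a + 1ℤ ≡ (+ 2) + a
      regroup = solve-∀

    -- S = Σ_{j≤K} 1/(2j) modulo p; the j = 0 term is 0^n = 0.
    evenInverses : ℤ
    evenInverses = ∑ (suc K) (λ j → inverse (2 ℕ.* j))

    inverse-1 : inverse 1 ≡ 1ℤ
    inverse-1 = ℤ.^-zeroˡ n

    odd-inverses≈ : ∑ (suc K) (λ j → inverse (suc (2 ℕ.* j))) ≈ - ∑ (suc K) (λ j → inverse (2 ℕ.* suc j))
    odd-inverses≈ = begin
      ∑ (suc K) (λ j → inverse (suc (2 ℕ.* j)))               ≡⟨ ∑-reverse (suc K) _ ⟩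
      ∑ (suc K) (λ j → inverse (suc (2 ℕ.* (K ℕ.∸ j))))
                                                              ≈⟨ ∑-cong≈ (suc K) (λ j j≤K → inverse-reflect (sum≡p j (ℕ.≤-pred j≤K))) ⟩
      ∑ (suc K) (λ j → - inverse (2 ℕ.* suc j))               ≡⟨ ∑-neg (suc K) _ ⟩
      - ∑ (suc K) (λ j → inverse (2 ℕ.* suc j))               ∎
      where
      open SetoidReasoning ≈-setoid
      sum≡p : ∀ j → j ≤ K → suc (2 ℕ.* (K ℕ.∸ j)) ℕ.+ 2 ℕ.* suc j ≡ p
      sum≡p j j≤K = trans (regroup (K ℕ.∸ j) j) (cong (λ k → 3 ℕ.+ 2 ℕ.* k) (ℕ.m∸n+n≡m j≤K))
        where
        regroup : ∀ d j → suc (2 ℕ.* d) ℕ.+ 2 ℕ.* suc j ≡ 3 ℕ.+ 2 ℕ.* (d ℕ.+ j)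
        regroup = ℕ-solve-∀

    two-q : + (2 ℕ.* q) ≈ + 2 - + 2 * evenInverses
    two-q = begin
      + (2 ℕ.* q)                                                      ≡⟨ two-q-exact ⟩
      ∑ (suc n) (λ k → + ((p C suc k) / p))                    ≈⟨ ∑-cong≈ (suc n) (λ k → binomial-quotient) ⟩
      ∑ (suc n) f                                              ≡⟨ cong (λ m → ∑ m f) (ℕ.*-suc 2 K) ⟨
      ∑ (2 ℕ.* suc K) f                                                ≡⟨ ∑-pairs (suc K) f ⟩
      ∑ (suc K) (λ j → f (2 ℕ.* j) + f (suc (2 ℕ.* j)))                ≡⟨ ∑-cong (suc K) (λ j _ → alternate j) ⟩
      ∑ (suc K) (λ j → odd j + - even j)
                                                                       ≡⟨ trans (∑-+ (suc K) odd _) (cong (_+_ (∑ (suc K) odd)) (∑-neg (suc K) even)) ⟩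
      ∑ (suc K) odd - ∑ (suc K) even                                   ≈⟨ +-cong odd-inverses≈ ≈-refl ⟩
      - ∑ (suc K) even - ∑ (suc K) even                                ≡⟨ cong (λ s → - s - s) evens ⟩
      - (evenInverses + inverse (2 ℕ.* suc K)) - (evenInverses + inverse (2 ℕ.* suc K))
                                                                       ≈⟨ +-cong (-‿cong last≈) (-‿cong last≈) ⟩
      - (evenInverses + - 1ℤ) - (evenInverses + - 1ℤ)                  ≡⟨ regroup evenInverses ⟩
      + 2 - + 2 * evenInverses                                         ∎
      where
      open SetoidReasoning ≈-setoid
      f : ℕ → ℤ
      f k = -1ℤ ^ k * inverse (suc k)
      odd even : ℕ → ℤ
      odd j  = inverse (suc (2 ℕ.* j))
      even j = inverse (2 ℕ.* suc j)
      alternate : ∀ j → f (2 ℕ.* j) + f (suc (2 ℕ.* j)) ≡ odd j + - even j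
      alternate j = cong₂ _+_
        (trans (cong (_* odd j) (-1^even j)) (ℤ.*-identityˡ (odd j)))
        (trans (cong₂ (λ s m → -1ℤ * s * inverse m) (-1^even j) (sym (ℕ.*-suc 2 j))) (ℤ.-1*i≡-i (even j)))
      evens : ∑ (suc K) even ≡ evenInverses + inverse (2 ℕ.* suc K)
      evens = trans (sym (ℤ.+-identityˡ _)) (sym (∑-shift (suc K) (λ j → inverse (2 ℕ.* j))))
      last≈ : evenInverses + inverse (2 ℕ.* suc K) ≈ evenInverses + - 1ℤ
      last≈ = +-cong (≈-refl {evenInverses})
                     (≈-trans (inverse-reflect {2 ℕ.* suc K} {1} (trans (cong (ℕ._+ 1) (ℕ.*-suc 2 K)) (ℕ.+-comm (suc n) 1)))
                                     (-‿cong (≈-reflexive inverse-1)))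
      regroup : ∀ s → - (s + - 1ℤ) - (s + - 1ℤ) ≡ + 2 - + 2 * s
      regroup = solve-∀

    adjacentInverses : ℕ → ℤ
    adjacentInverses j = inverse (2 ℕ.* j) + inverse (suc (2 ℕ.* j))

    evenIndicator≈binomials : ∀ a → a ≤ n → + indicator (isEven a) ≈ + ∑ℕ (suc K) (λ i → (2 ℕ.* suc i ℕ.+ a) C suc n)
    evenIndicator≈binomials a a≤n = ≈-sym (begin
      + ∑ℕ (suc K) (λ i → (2 ℕ.* suc i ℕ.+ a) C suc n)      ≡⟨ pos-∑ℕ (suc K) _ ⟩
      ∑ (suc K) (λ i → + ((2 ℕ.* suc i ℕ.+ a) C suc n))
                                                           ≈⟨ ∑-cong≈ (suc K) (λ i i≤K → C≈δ _ (bound i (ℕ.≤-pred i≤K))) ⟩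
      ∑ (suc K) (λ i → δ (2 ℕ.* suc i ℕ.+ a) (suc n))
                                                           ≡⟨ cong (λ t → ∑ (suc K) (λ i → δ (2 ℕ.* suc i ℕ.+ a) t)) (ℕ.*-suc 2 K) ⟨
      ∑ (suc K) (λ i → δ (2 ℕ.* suc i ℕ.+ a) (2 ℕ.* suc K)) ≡⟨ even-hits K a a≤n ⟩
      + indicator (isEven a)                               ∎)
      where
      open SetoidReasoning ≈-setoid
      bound : ∀ i → i ≤ K → 2 ℕ.* suc i ℕ.+ a < p ℕ.+ suc n
      bound i i≤K = ℕ.≤-trans (s≤s (ℕ.+-mono-≤ (ℕ.*-monoʳ-≤ 2 (s≤s i≤K)) a≤n))
                              (subst (suc (2 ℕ.* suc K ℕ.+ n) ℕ.≤_) (total K) (ℕ.m≤m+n _ 1))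
        where
        total : ∀ K → suc (2 ℕ.* suc K ℕ.+ suc (2 ℕ.* K)) ℕ.+ 1 ≡ (3 ℕ.+ 2 ℕ.* K) ℕ.+ suc (suc (2 ℕ.* K))
        total = ℕ-solve-∀


    worpitzky-inverses : ∀ i →
      + sum (map (λ σ → (2 ℕ.* suc i ℕ.+ ascents σ) C suc n) (permsByInsertion n)) ≡ ∑ (suc i) adjacentInverses
    worpitzky-inverses i = begin
      + sum (map (λ σ → (2 ℕ.* suc i ℕ.+ ascents σ) C suc n) (permsByInsertion n))
                                                    ≡⟨ cong +_ (worpitzky-cumulative n (2 ℕ.* suc i)) ⟩
      + ∑ℕ (2 ℕ.* suc i) (ℕ._^ n)                   ≡⟨ pos-∑ℕ (2 ℕ.* suc i) _ ⟩
      ∑ (2 ℕ.* suc i) (λ m → + (m ℕ.^ n))           ≡⟨ ∑-cong (2 ℕ.* suc i) (λ m _ → pos-^ m n) ⟩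
      ∑ (2 ℕ.* suc i) inverse                       ≡⟨ ∑-pairs (suc i) inverse ⟩
      ∑ (suc i) adjacentInverses                    ∎
      where open ≡-Reasoning

    evenAscentCount≈ : + evenAscentCount n ≈ ∑ (suc K) (λ i → ∑ (suc i) adjacentInverses)
    evenAscentCount≈ = begin
      + evenAscentCount n
        ≈⟨ sum-map-cong≈ L (λ σ∈ → evenIndicator≈binomials _ (ascents-permsByInsertion n σ∈)) ⟩
      + sum (map (λ σ → ∑ℕ (suc K) (λ i → (2 ℕ.* suc i ℕ.+ ascents σ) C suc n)) L)
        ≡⟨ cong +_ (sum-map-∑ℕ (suc K) (λ σ i → (2 ℕ.* suc i ℕ.+ ascents σ) C suc n) L) ⟩
      + ∑ℕ (suc K) (λ i → sum (map (λ σ → (2 ℕ.* suc i ℕ.+ ascents σ) C suc n) L))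
        ≡⟨ pos-∑ℕ (suc K) _ ⟩
      ∑ (suc K) (λ i → + sum (map (λ σ → (2 ℕ.* suc i ℕ.+ ascents σ) C suc n) L))
        ≡⟨ ∑-cong (suc K) (λ i _ → worpitzky-inverses i) ⟩
      ∑ (suc K) (λ i → ∑ (suc i) adjacentInverses) ∎
      where
      open SetoidReasoning ≈-setoid
      L = permsByInsertion n

    weightedPair : ℕ → ℤ
    weightedPair j = + (2 ℕ.* j) * inverse (2 ℕ.* j) + + suc (2 ℕ.* j) * inverse (suc (2 ℕ.* j))

    weighted-inverses : ∑ (suc K) weightedPair ≈ + n
    weighted-inverses = begin
      ∑ (suc K) weightedPair                       ≡⟨ ∑-pairs (suc K) w ⟨
      ∑ (2 ℕ.* suc K) w                            ≡⟨ cong (λ m → ∑ m w) (ℕ.*-suc 2 K) ⟩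
      ∑ (suc n) w                                  ≡⟨ ∑-shift n w ⟩
      0ℤ + ∑ n (w ∘ suc)                           ≈⟨ +-cong (≈-refl {0ℤ}) (∑-cong≈ n (λ m m<n → inverse-correct (s≤s z≤n) (ℕ.m<n⇒m<1+n (s≤s m<n)))) ⟩
      0ℤ + ∑ n (λ _ → 1ℤ)                          ≡⟨ ℤ.+-identityˡ _ ⟩
      ∑ n (λ _ → 1ℤ)                               ≡⟨ trans (∑-const n 1ℤ) (ℤ.*-identityʳ (+ n)) ⟩
      + n                                          ∎
      where
      open SetoidReasoning ≈-setoid
      w : ℕ → ℤ
      w m = + m * inverse m

    -- 2(K + 1 − j) ≡ −(2j + 1) modulo p = 2K + 3.
    two-weights≈ : ∀ j → + 2 * ((+ suc K - + j) * adjacentInverses j) ≈ - weightedPair j - inverse (2 ℕ.* j)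
    two-weights≈ j = mk≈ (adjacentInverses j)
      (trans (expand (+ K) (+ j) a b)
             (cong₂ (λ u v → - (u * a + (1ℤ + u) * b) - a + (a + b) * (+ 3 + v)) (sym (ℤ.pos-* 2 j)) (sym (ℤ.pos-* 2 K))))
      where
      a = inverse (2 ℕ.* j)
      b = inverse (suc (2 ℕ.* j))
      expand : ∀ k j a b → + 2 * ((1ℤ + k - j) * (a + b)) ≡ - (+ 2 * j * a + (1ℤ + + 2 * j) * b) - a + (a + b) * (+ 3 + + 2 * k)
      expand = solve-∀

    two-evenAscentCount : + (2 ℕ.* evenAscentCount n) ≈ - + n - evenInverses
    two-evenAscentCount = begin
      + (2 ℕ.* evenAscentCount n)
        ≡⟨ ℤ.pos-* 2 (evenAscentCount n) ⟩
      + 2 * + evenAscentCount n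
        ≈⟨ *-cong (≈-refl {+ 2}) evenAscentCount≈ ⟩
      + 2 * ∑ (suc K) (λ i → ∑ (suc i) adjacentInverses)
        ≡⟨ cong (+ 2 *_) (∑-triangle (suc K) adjacentInverses) ⟩
      + 2 * ∑ (suc K) (λ j → (+ suc K - + j) * adjacentInverses j)
        ≡⟨ ∑-*ˡ (suc K) (+ 2) _ ⟨
      ∑ (suc K) (λ j → + 2 * ((+ suc K - + j) * adjacentInverses j))
        ≈⟨ ∑-cong≈ (suc K) (λ j _ → two-weights≈ j) ⟩
      ∑ (suc K) (λ j → - weightedPair j - inverse (2 ℕ.* j))
        ≡⟨ trans (∑-+ (suc K) _ _) (cong₂ _+_ (∑-neg (suc K) weightedPair) (∑-neg (suc K) _)) ⟩
      - ∑ (suc K) weightedPair - evenInverses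
        ≈⟨ +-cong (-‿cong weighted-inverses) ≈-refl ⟩
      - + n - evenInverses ∎
      where open SetoidReasoning ≈-setoid

    identity-evenAscents : isEvenAscents (identity n) ≡ true
    identity-evenAscents = trans (cong isEven (ascents-applyUpTo (λ i → i) (2 ℕ.* K) ℕ.n<1+n)) (isEven-even K)

    congruence : q % p ≡ (2 ℕ.* M n ℕ.+ 1) % p
    congruence = ≈⇒%≡ {q} {2 ℕ.* M n ℕ.+ 1} (cancelˡ p-prime (+ 2) (prime∤ (s≤s z≤n) (s≤s (s≤s (s≤s z≤n)))) (begin
      + 2 * + q                                ≡⟨ ℤ.pos-* 2 q ⟨
      + (2 ℕ.* q)                              ≈⟨ two-q ⟩
      + 2 - + 2 * evenInverses                 ≈⟨ mk≈ (+ 2) (shift (+ n) evenInverses) ⟩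
      + 2 * (- + n - evenInverses) - + 2       ≈⟨ +-cong (*-cong (≈-refl {+ 2}) two-evenAscentCount) (≈-refl { - + 2}) ⟨
      + 2 * + (2 ℕ.* evenAscentCount n) - + 2
                                               ≡⟨ cong (λ e → + 2 * + (2 ℕ.* e) - + 2) (suc-M≡evenAscentCount n identity-evenAscents) ⟨
      + 2 * + (2 ℕ.* suc (M n)) - + 2          ≡⟨ unfold (M n) ⟩
      + 2 * + (2 ℕ.* M n ℕ.+ 1)                ∎))
      where
      open SetoidReasoning ≈-setoid
      shift : ∀ m s → + 2 - + 2 * s ≡ + 2 * (- m - s) - + 2 + + 2 * (+ 2 + m)
      shift = solve-∀
      unfold : ∀ m → + 2 * + (2 ℕ.* suc m) - + 2 ≡ + 2 * + (2 ℕ.* m ℕ.+ 1)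
      unfold m = trans (cong (λ t → + 2 * t - + 2) (ℤ.pos-* 2 (suc m)))
                (trans (normalise (+ m))
                       (cong (+ 2 *_) (trans (cong (_+ 1ℤ) (sym (ℤ.pos-* 2 m))) (sym (ℤ.pos-+ (2 ℕ.* m) 1)))))
        where
        normalise : ∀ m → + 2 * (+ 2 * (1ℤ + m)) - + 2 ≡ + 2 * (+ 2 * m + 1ℤ)
        normalise = solve-∀


open import Data.Nat using (ℕ; _+_; _*_; _∸_; _^_; NonZero)
open import Data.Nat.Primality using (Prime)
open import Data.Nat.DivMod using (_/_; _%_)

open import Data.Nat using (zero; suc)
import Data.Nat.Properties as ℕ
open import Data.Nat.Divisibility using (divides)
open import Data.Nat.Primality using (prime⇒irreducible; ¬prime[1])
open Arithmetic using (parity; module OddPrime)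

odd-prime : ∀ {p} → Prime p → p ≢ 2 → ∃[ K ] p ≡ 3 + 2 * K
odd-prime {p} p-prime p≢2 with parity p
... | e , inj₁ refl with prime⇒irreducible p-prime (divides e (ℕ.*-comm 2 e))
...   | inj₁ ()
...   | inj₂ 2≡p = contradiction (sym 2≡p) p≢2
odd-prime {p} p-prime p≢2 | zero  , inj₂ refl = contradiction p-prime ¬prime[1]
odd-prime {p} p-prime p≢2 | suc K , inj₂ refl = K , cong suc (ℕ.*-suc 2 K)

theorem1 : (p : ℕ) → Prime p → p ≢ 2 → .{{_ : NonZero p}} →
    ((2 ^ (p ∸ 1) ∸ 1) / p) % p ≡ (2 * M (p ∸ 2) + 1) % p
theorem1 p p-prime p≢2 with odd-prime p-prime p≢2
... | K , refl = OddPrime.congruence K p-prime
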